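{- Let $n\ge 2$ and $v\in B_n$. For every $1\le i<n$, $$s_i\star v=h_{i,[i+1]}(s_iv),$$ and moreover $$s_n\star v=h_{n,[-n]}(s_nv).$$
   Context: Let $\pm[n]=\{1,\dots,n,-1,\dots,-n\}$, totally ordered by $1<2<\cdots<n<-n<\cdots<-1$. Signed permutations: - $B_n$ is the group of bijections $w$ of $\pm[n]$ with $w(-x)=-w(x)$, written $[w(1),\dots,w(n)]$. - The product is composition, so left multiplication by $u$ replaces each entry $x$ by $u(x)$. - The unfolding of $w$ is $w(1),\dots,w(n),-w(n),\dots,-w(1)$. - The generators are as follows: for $i<n$, $s_i$ swaps $i\leftrightarrow i+1$ and $-i\leftrightarrow-(i+1)$; the generator $s_n$ swaps $n\leftrightarrow -n$. - $\ell$ is Coxeter length. The Demazure product satisfies $s\star u=u$ if $\ell(su)<\ell(u)$ and $s\star u=su$ otherwise, for each generator $s$. Hopping operator: let $t\in\pm[n]$ and let $L$ be an ordered list of distinct elements of $\pm[n]$. The map $h_{t,L}:B_n\to B_n$ acts on $w$ by the following iteration. - In the unfolding of $w$, consider the entries to the right of $t$ that lie in $L$ and are greater than $t$ in the total order. - If there are none, stop. - Otherwise, let $q$ be the one among them occurring latest in $L$. Swap $t$ with $q$, and also swap $-t$ with $-q$ (unless $t=-q$), then repeat. -}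

module Defs where

open import Data.Nat using (ℕ; zero; suc; _+_; _*_; _∸_; _<_; _≤_; _<?_)
open import Data.Fin using (Fin; toℕ; fromℕ<)
import Data.Fin as F
open import Data.List using (List; []; _∷_; length)
open import Data.Maybe using (Maybe; just; nothing)
open import Data.Product using (Σ; _×_; _,_)
open import Relation.Binary.PropositionalEquality using (_≡_; refl; cong)
open import Relation.Nullary using (Dec; yes; no; ¬_)
open import Function using (_∘_; id)

-- The signed alphabet ±[n]:  pos k  stands for  k+1,  neg k  for  -(k+1).

data PM (n : ℕ) : Set where
  pos : Fin n → PM n
  neg : Fin n → PM n

-_ : {n : ℕ} → PM n → PM n
- pos k = neg k
- neg k = pos k

_≟PM_ : {n : ℕ} → (x y : PM n) → Dec (x ≡ y)
pos a ≟PM pos b with a F.≟ b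
... | yes refl = yes refl
... | no a≢b = no λ { refl → a≢b refl }
pos a ≟PM neg b = no λ ()
neg a ≟PM pos b = no λ ()
neg a ≟PM neg b with a F.≟ b
... | yes refl = yes refl
... | no a≢b = no λ { refl → a≢b refl }

-- The total order 1 < 2 < ... < n < -n < ... < -1, encoded by the rank
-- of an element in that order (0-based).
rank : {n : ℕ} → PM n → ℕ
rank     (pos k) = toℕ k
rank {n} (neg k) = n + (n ∸ suc (toℕ k))

_<PM_ : {n : ℕ} → PM n → PM n → Set
x <PM y = rank x < rank y

_<PM?_ : {n : ℕ} → (x y : PM n) → Dec (x <PM y)
x <PM? y = rank x <? rank y

record Perm (n : ℕ) : Set where
  constructor perm
  field
    fun : PM n → PM n
    inv : PM n → PM n
open Perm public

record IsSignedPerm {n : ℕ} (w : Perm n) : Set where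
  field
    odd     : ∀ x → fun w (- x) ≡ - (fun w x)
    inv-fun : ∀ x → inv w (fun w x) ≡ x
    fun-inv : ∀ x → fun w (inv w x) ≡ x

record B (n : ℕ) : Set where
  field
    perm'  : Perm n
    signed : IsSignedPerm perm'
open B public

_≈_ : {n : ℕ} → Perm n → Perm n → Set
u ≈ w = ∀ x → fun u x ≡ fun w x

_·_ : {n : ℕ} → Perm n → Perm n → Perm n
u · w = perm (fun u ∘ fun w) (inv w ∘ inv u)

idP : {n : ℕ} → Perm n
idP = perm id id

-- The signed transposition swapping t ↔ q and -t ↔ -q
-- (when t = -q this is just the swap t ↔ -t).  It is an involution.
τfun : {n : ℕ} → PM n → PM n → PM n → PM n
τfun t q x with x ≟PM t
... | yes _ = q
... | no _ with x ≟PM q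
...   | yes _ = t
...   | no _ with x ≟PM (- t)
...     | yes _ = - q
...     | no _ with x ≟PM (- q)
...       | yes _ = - t
...       | no _ = x

τ : {n : ℕ} → PM n → PM n → Perm n
τ t q = perm (τfun t q) (τfun t q)

-- Coxeter generators.  The index j : Fin n denotes s_{j+1}:
-- for j+1 < n, s_{j+1} swaps j+1 ↔ j+2 and -(j+1) ↔ -(j+2);
-- for j+1 = n, s_n swaps n ↔ -n.

gen : {n : ℕ} → Fin n → Perm n
gen {n} j with suc (toℕ j) <? n
... | yes p = τ (pos j) (pos (fromℕ< p))
... | no _  = τ (pos j) (neg j)

eval : {n : ℕ} → List (Fin n) → Perm n
eval []       = idP
eval (j ∷ js) = gen j · eval js

HasLength : {n : ℕ} → Perm n → ℕ → Set
HasLength {n} w k =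
  Σ (List (Fin n)) (λ ws → (length ws ≡ k) × (eval ws ≈ w))
  × (∀ (ws : List (Fin n)) → eval ws ≈ w → k ≤ length ws)

-- Demazure product with a generator:  IsDemazure s u r  means  s ⋆ u = r,
-- i.e. r = u if ℓ(su) < ℓ(u), and r = su otherwise.
IsDemazure : {n : ℕ} → Perm n → Perm n → Perm n → Set
IsDemazure s u r =
  ∀ (a b : ℕ) → HasLength (s · u) a → HasLength u b →
    ((a < b) → r ≈ u) × (¬ (a < b) → r ≈ (s · u))

-- Hopping operator h_{t,L}.
-- Position of value y in the unfolding w(1),...,w(n),-w(n),...,-w(1)
-- is the rank of w⁻¹(y); so "q lies to the right of t" is
-- w⁻¹(t) <PM w⁻¹(q).

eligible : {n : ℕ} → Perm n → PM n → List (PM n) → List (PM n)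
eligible w t [] = []
eligible w t (q ∷ L) with t <PM? q | inv w t <PM? inv w q
... | yes _ | yes _ = q ∷ eligible w t L
... | _     | _     = eligible w t L

lastElem : {A : Set} → List A → Maybe A
lastElem []       = nothing
lastElem (x ∷ []) = just x
lastElem (x ∷ y ∷ xs) = lastElem (y ∷ xs)

hopStep : {n : ℕ} → PM n → List (PM n) → Perm n → Maybe (Perm n)
hopStep t L w with lastElem (eligible w t L)
... | nothing = nothing
... | just q  = just (τ t q · w)

hopIter : {n : ℕ} → ℕ → PM n → List (PM n) → Perm n → Perm n
hopIter zero    t L w = w
hopIter (suc k) t L w with hopStep t L w
... | nothing = w
... | just w' = hopIter k t L w'

-- Each hop moves t strictly to the right in the unfolding (length 2n),
-- so 2n iterations suffice for the process to stop.
hop : {n : ℕ} → PM n → List (PM n) → Perm n → Perm n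
hop {n} t L w = hopIter (2 * n) t L w

{-# OPTIONS --safe #-}
-- Left multiplication by sᵢ exchanges the letters i and i+1 (for sₙ: n and −n) in the
-- unfolding.  Hence in sᵢv the letter i hops over i+1 at most once, namely when i+1 stands
-- left of i in the unfolding of v, and then the hop restores v.  So both sides equal v if
-- i+1 precedes i in v and sᵢv otherwise, and it remains to show that ℓ(sᵢv) < ℓ(v) exactly
-- when i+1 precedes i.
--
-- For this w is read through its position function f (f x is where the letter of rank x
-- stands in the unfolding), a permutation of [0, 2n) commuting with x ↦ 2n−1−x.  Then
-- inv(f) + neg(w) = 2ℓ(w): it vanishes only at the identity, since a mirror-symmetric f
-- increasing on [0, n] is the identity, and sᵢ, which swaps the arguments of f belonging
-- to i, i+1 (and to −i−1, −i when i < n), changes it by −2 if i+1 precedes i and by +2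
-- otherwise.
module Submission where

open import Defs
open import Data.Nat
open import Data.Nat.Properties
open import Data.Nat.Tactic.RingSolver using (solve-∀)
open import Data.Fin using (Fin; toℕ; fromℕ; fromℕ<)
import Data.Fin.Properties as Fin
open import Data.List using (List; []; _∷_; length)
open import Data.Maybe using (just; nothing)
open import Data.Product using (Σ; _×_; _,_)
open import Data.Sum using (inj₁; inj₂)
open import Data.Empty using (⊥-elim)
open import Function using (_∘_; _∘′_)
open import Relation.Binary.PropositionalEquality
open import Relation.Nullary using (¬_; Dec; yes; no)
open import Algebra.Properties.CommutativeSemigroup +-commutativeSemigroup
  using (xy∙z≈xz∙y; x∙yz≈y∙xz)

⟦_<_⟧ : ℕ → ℕ → ℕ
⟦ a     < zero  ⟧ = 0
⟦ zero  < suc b ⟧ = 1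
⟦ suc a < suc b ⟧ = ⟦ a < b ⟧

⟦<⟧-yes : ∀ {a b} → a < b → ⟦ a < b ⟧ ≡ 1
⟦<⟧-yes {zero}  {suc b} _         = refl
⟦<⟧-yes {suc a} {suc b} (s≤s a<b) = ⟦<⟧-yes a<b

⟦<⟧-no : ∀ {a b} → b ≤ a → ⟦ a < b ⟧ ≡ 0
⟦<⟧-no {a}     {zero}  _         = refl
⟦<⟧-no {suc a} {suc b} (s≤s b≤a) = ⟦<⟧-no b≤a

sumBelow : ℕ → (ℕ → ℕ) → ℕ
sumBelow zero    h = 0
sumBelow (suc L) h = sumBelow L h + h L

syntax sumBelow L (λ x → e) = ∑[ x < L ] e

sumBelow-cong : ∀ L {h g : ℕ → ℕ} → (∀ x → x < L → h x ≡ g x) → sumBelow L h ≡ sumBelow L g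
sumBelow-cong zero    h≗g = refl
sumBelow-cong (suc L) h≗g =
  cong₂ _+_ (sumBelow-cong L (λ x x<L → h≗g x (m<n⇒m<1+n x<L))) (h≗g L (n<1+n L))

sumBelow-zero : ∀ L {h : ℕ → ℕ} → (∀ x → x < L → h x ≡ 0) → sumBelow L h ≡ 0
sumBelow-zero zero    h≗0 = refl
sumBelow-zero (suc L) h≗0 =
  cong₂ _+_ (sumBelow-zero L (λ x x<L → h≗0 x (m<n⇒m<1+n x<L))) (h≗0 L (n<1+n L))

swapAdj : ℕ → ℕ → ℕ
swapAdj a x with x ≟ a
... | yes _ = suc a
... | no _ with x ≟ suc a
...   | yes _ = a
...   | no _  = x

swapAdj-left : ∀ a → swapAdj a a ≡ suc a
swapAdj-left a with a ≟ a
... | yes _  = refl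
... | no a≢a = ⊥-elim (a≢a refl)

swapAdj-right : ∀ a → swapAdj a (suc a) ≡ a
swapAdj-right a with suc a ≟ a
... | yes 1+a≡a = ⊥-elim (1+n≢n 1+a≡a)
... | no _ with suc a ≟ suc a
...   | yes _      = refl
...   | no 1+a≢1+a = ⊥-elim (1+a≢1+a refl)

swapAdj-other : ∀ a x → x ≢ a → x ≢ suc a → swapAdj a x ≡ x
swapAdj-other a x x≢a x≢1+a with x ≟ a
... | yes x≡a = ⊥-elim (x≢a x≡a)
... | no _ with x ≟ suc a
...   | yes x≡1+a = ⊥-elim (x≢1+a x≡1+a)
...   | no _      = refl

swapAdj-below : ∀ a x → x < a → swapAdj a x ≡ x
swapAdj-below a x x<a = swapAdj-other a x (<⇒≢ x<a) (<⇒≢ (m<n⇒m<1+n x<a))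

swapAdj-above : ∀ a x → suc a < x → swapAdj a x ≡ x
swapAdj-above a x a+1<x =
  swapAdj-other a x (≢-sym (<⇒≢ (<-trans (n<1+n a) a+1<x))) (≢-sym (<⇒≢ a+1<x))

sumBelow-swapAdj : ∀ k L (h : ℕ → ℕ) → suc k < L → sumBelow L (h ∘ swapAdj k) ≡ sumBelow L h
sumBelow-swapAdj k (suc L) h (s≤s k+1≤L) with m≤n⇒m<n∨m≡n k+1≤L
... | inj₁ k+1<L =
  cong₂ _+_ (sumBelow-swapAdj k L h k+1<L) (cong h (swapAdj-above k L k+1<L))
... | inj₂ refl = begin
  (sumBelow k (h ∘ swapAdj k) + h (swapAdj k k)) + h (swapAdj k (suc k))
    ≡⟨ cong₂ (λ s t → (s + h t) + h (swapAdj k (suc k)))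
             (sumBelow-cong k (λ x x<k → cong h (swapAdj-below k x x<k))) (swapAdj-left k) ⟩
  (sumBelow k h + h (suc k)) + h (swapAdj k (suc k))
    ≡⟨ cong (λ t → (sumBelow k h + h (suc k)) + h t) (swapAdj-right k) ⟩
  (sumBelow k h + h (suc k)) + h k
    ≡⟨ xy∙z≈xz∙y (sumBelow k h) (h (suc k)) (h k) ⟩
  (sumBelow k h + h k) + h (suc k) ∎
  where open ≡-Reasoning

countAbove : ℕ → ℕ → (ℕ → ℕ) → ℕ
countAbove v L f = ∑[ x < L ] ⟦ v < f x ⟧

inversions : ℕ → (ℕ → ℕ) → ℕ
inversions L f = ∑[ y < L ] countAbove (f y) y f

countAbove-cong : ∀ v L {f g : ℕ → ℕ} → (∀ x → x < L → f x ≡ g x) → countAbove v L f ≡ countAbove v L g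
countAbove-cong v L f≗g = sumBelow-cong L (λ x x<L → cong ⟦ v <_⟧ (f≗g x x<L))

inversions-cong : ∀ L {f g : ℕ → ℕ} → (∀ x → x < L → f x ≡ g x) → inversions L f ≡ inversions L g
inversions-cong L {f} f≗g = sumBelow-cong L λ y y<L →
  trans (cong (λ v → countAbove v y f) (f≗g y y<L))
        (countAbove-cong _ y (λ x x<y → f≗g x (<-trans x<y y<L)))

inversions-swapAdj : ∀ k L (f : ℕ → ℕ) → suc k < L → f (suc k) < f k →
  inversions L (f ∘ swapAdj k) + 1 ≡ inversions L f
inversions-swapAdj k (suc L) f (s≤s k+1≤L) descent with m≤n⇒m<n∨m≡n k+1≤L
... | inj₁ k+1<L = begin
  (inversions L (f ∘ swapAdj k) + countAbove (f (swapAdj k L)) L (f ∘ swapAdj k)) + 1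
    ≡⟨ cong (λ v → (inversions L (f ∘ swapAdj k) + countAbove (f v) L (f ∘ swapAdj k)) + 1)
            (swapAdj-above k L k+1<L) ⟩
  (inversions L (f ∘ swapAdj k) + countAbove (f L) L (f ∘ swapAdj k)) + 1
    ≡⟨ xy∙z≈xz∙y (inversions L (f ∘ swapAdj k)) _ 1 ⟩
  (inversions L (f ∘ swapAdj k) + 1) + countAbove (f L) L (f ∘ swapAdj k)
    ≡⟨ cong₂ _+_ (inversions-swapAdj k L f k+1<L descent)
                 (sumBelow-swapAdj k L (λ x → ⟦ f L < f x ⟧) k+1<L) ⟩
  inversions L f + countAbove (f L) L f ∎
  where open ≡-Reasoning
... | inj₂ refl = begin
  ((I′ + C′ (f (swapAdj k k))) + (C′ (f (swapAdj k (suc k)))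
                                  + ⟦ f (swapAdj k (suc k)) < f (swapAdj k k) ⟧)) + 1
    ≡⟨ cong₂ (λ a b → ((I′ + C′ (f a)) + (C′ (f b) + ⟦ f b < f a ⟧)) + 1)
             (swapAdj-left k) (swapAdj-right k) ⟩
  ((I′ + C′ (f (suc k))) + (C′ (f k) + ⟦ f k < f (suc k) ⟧)) + 1
    ≡⟨ cong₂ (λ i a → ((i + C′ (f (suc k))) + (C′ (f k) + a)) + 1)
             (inversions-cong k below) (⟦<⟧-no (<⇒≤ descent)) ⟩
  ((I + C′ (f (suc k))) + (C′ (f k) + 0)) + 1
    ≡⟨ cong₂ (λ a b → ((I + a) + (b + 0)) + 1) (countAbove-cong _ k below) (countAbove-cong _ k below) ⟩
  ((I + C (f (suc k))) + (C (f k) + 0)) + 1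
    ≡⟨ rearrange I (C (f (suc k))) (C (f k)) ⟩
  (I + C (f k)) + (C (f (suc k)) + 1)
    ≡⟨ cong (λ a → (I + C (f k)) + (C (f (suc k)) + a)) (sym (⟦<⟧-yes descent)) ⟩
  inversions (suc (suc k)) f ∎
  where
  open ≡-Reasoning
  f′ = f ∘ swapAdj k
  I′ = inversions k f′
  I  = inversions k f
  C′ C : ℕ → ℕ
  C′ v = countAbove v k f′
  C  v = countAbove v k f
  below : ∀ x → x < k → f′ x ≡ f x
  below x x<k = cong f (swapAdj-below k x x<k)
  rearrange : ∀ i a b → ((i + a) + (b + 0)) + 1 ≡ (i + b) + (a + 1)
  rearrange = solve-∀

<-complement : ∀ {a b d e s} → a + d ≡ s → b + e ≡ s → a < b → e < d
<-complement a+d≡s b+e≡s a<b =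
  ≰⇒> λ d≤e → <-irrefl (trans a+d≡s (sym b+e≡s)) (+-mono-<-≤ a<b d≤e)

≤-complement : ∀ {a b d e s} → a + d ≡ s → b + e ≡ s → a ≤ b → e ≤ d
≤-complement a+d≡s b+e≡s a≤b =
  ≮⇒≥ λ d<e → <-irrefl (trans a+d≡s (sym b+e≡s)) (+-mono-≤-< a≤b d<e)

+≡⇒∸≡ : ∀ {a b s} → a + b ≡ s → s ∸ a ≡ b
+≡⇒∸≡ {a} {b} refl = m+n∸m≡n a b

module Mirror (m : ℕ) where

  n ω : ℕ
  n = suc m
  ω = m + n

  Mirrored : (ℕ → ℕ) → Set
  Mirrored f = ∀ {x y} → x + y ≡ ω → f x + f y ≡ ω

  <⇒<1+ω : ∀ {x} → x < n → x < suc ω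
  <⇒<1+ω x<n = ≤-trans x<n (m≤n+m n (suc m))

  doubledLength : (ℕ → ℕ) → ℕ
  doubledLength f = inversions (suc ω) f + countAbove m n f

  doubledLength-cong : ∀ {f g : ℕ → ℕ} → (∀ x → x < suc ω → f x ≡ g x) →
    doubledLength f ≡ doubledLength g
  doubledLength-cong f≗g =
    cong₂ _+_ (inversions-cong (suc ω) f≗g)
              (countAbove-cong m n (λ x x<n → f≗g x (<⇒<1+ω x<n)))

  doubledLength-id : ∀ {f : ℕ → ℕ} → (∀ x → x < suc ω → f x ≡ x) → doubledLength f ≡ 0
  doubledLength-id f≗id = trans (doubledLength-cong f≗id) (cong₂ _+_
    (sumBelow-zero (suc ω) (λ y _ → sumBelow-zero y (λ x x<y → ⟦<⟧-no (<⇒≤ x<y))))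
    (sumBelow-zero n (λ x x<n → ⟦<⟧-no (≤-pred x<n))))

  n≤ω∸[1+k] : ∀ {k} → suc k < n → n ≤ ω ∸ suc k
  n≤ω∸[1+k] {k} k+1<n = subst (_≤ ω ∸ suc k) (m+n∸m≡n m n) (∸-monoʳ-≤ ω (≤-pred k+1<n))

  doubledLength-inner : ∀ f k → Mirrored f → suc k < n → f (suc k) < f k →
    doubledLength (f ∘ swapAdj (ω ∸ suc k) ∘ swapAdj k) + 2 ≡ doubledLength f
  doubledLength-inner f k mirrored k+1<n descent = begin
    (inversions (suc ω) (g ∘ swapAdj k) + countAbove m n (g ∘ swapAdj k)) + 2
      ≡⟨ cong (λ c → (inversions (suc ω) (g ∘ swapAdj k) + c) + 2) signChanges ⟩
    (inversions (suc ω) (g ∘ swapAdj k) + countAbove m n f) + 2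
      ≡⟨ rearrange (inversions (suc ω) (g ∘ swapAdj k)) _ ⟩
    ((inversions (suc ω) (g ∘ swapAdj k) + 1) + 1) + countAbove m n f
      ≡⟨ cong (λ i → (i + 1) + countAbove m n f) (inversions-swapAdj k (suc ω) g k+1<1+ω descentᵍ) ⟩
    (inversions (suc ω) g + 1) + countAbove m n f
      ≡⟨ cong (_+ countAbove m n f) (inversions-swapAdj a (suc ω) f a+1<1+ω mirrorDescent) ⟩
    doubledLength f ∎
    where
    open ≡-Reasoning
    a = ω ∸ suc k
    g = f ∘ swapAdj a
    k+1+a≡ω : suc k + a ≡ ω
    k+1+a≡ω = m+[n∸m]≡n (≤-trans (≤-pred k+1<n) (m≤m+n m n))
    n≤a : n ≤ a
    n≤a = n≤ω∸[1+k] k+1<n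
    k+1<a : suc k < a
    k+1<a = ≤-trans k+1<n n≤a
    k+1<1+ω : suc k < suc ω
    k+1<1+ω = s≤s (subst (suc k ≤_) k+1+a≡ω (m≤m+n (suc k) a))
    a+1<1+ω : suc a < suc ω
    a+1<1+ω = s≤s (subst (suc a ≤_) k+1+a≡ω (s≤s (m≤n+m a k)))
    descentᵍ : g (suc k) < g k
    descentᵍ = subst₂ _<_ (cong f (sym (swapAdj-below a (suc k) k+1<a)))
                          (cong f (sym (swapAdj-below a k (<-trans (n<1+n k) k+1<a)))) descent
    mirrorDescent : f (suc a) < f a
    mirrorDescent = <-complement (mirrored k+1+a≡ω) (mirrored (trans (+-suc k a) k+1+a≡ω)) descent
    signChanges : countAbove m n (g ∘ swapAdj k) ≡ countAbove m n f
    signChanges = trans (sumBelow-swapAdj k n (λ x → ⟦ m < g x ⟧) k+1<n)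
      (countAbove-cong m n (λ x x<n → cong f (swapAdj-below a x (≤-trans x<n n≤a))))
    rearrange : ∀ i c → (i + c) + 2 ≡ ((i + 1) + 1) + c
    rearrange = solve-∀

  doubledLength-last : ∀ f → Mirrored f → f n < f m →
    doubledLength (f ∘ swapAdj m) + 2 ≡ doubledLength f
  doubledLength-last f mirrored descent = begin
    (inversions (suc ω) (f ∘ swapAdj m) + (countAbove m m (f ∘ swapAdj m) + ⟦ m < f (swapAdj m m) ⟧)) + 2
      ≡⟨ cong₂ (λ c v → (inversions (suc ω) (f ∘ swapAdj m) + (c + ⟦ m < f v ⟧)) + 2)
               (countAbove-cong m m (λ x x<m → cong f (swapAdj-below m x x<m))) (swapAdj-left m) ⟩
    (inversions (suc ω) (f ∘ swapAdj m) + (countAbove m m f + ⟦ m < f n ⟧)) + 2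
      ≡⟨ cong (λ v → (inversions (suc ω) (f ∘ swapAdj m) + (countAbove m m f + v)) + 2) (⟦<⟧-no fn≤m) ⟩
    (inversions (suc ω) (f ∘ swapAdj m) + (countAbove m m f + 0)) + 2
      ≡⟨ rearrange (inversions (suc ω) (f ∘ swapAdj m)) (countAbove m m f) ⟩
    (inversions (suc ω) (f ∘ swapAdj m) + 1) + (countAbove m m f + 1)
      ≡⟨ cong₂ (λ i v → i + (countAbove m m f + v))
               (inversions-swapAdj m (suc ω) f (s≤s (m≤n+m n m)) descent) (sym (⟦<⟧-yes m<fm)) ⟩
    doubledLength f ∎
    where
    open ≡-Reasoning
    fm+fn≡ω : f m + f n ≡ ω
    fm+fn≡ω = mirrored refl
    m<fm : m < f m
    m<fm = ≰⇒> λ fm≤m → <-irrefl fm+fn≡ω (+-mono-≤-< fm≤m (<-≤-trans descent (m≤n⇒m≤1+n fm≤m)))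
    fn≤m : f n ≤ m
    fn≤m = ≤-complement (+-comm n m) fm+fn≡ω m<fm
    rearrange : ∀ i c → (i + (c + 0)) + 2 ≡ (i + 1) + (c + 1)
    rearrange = solve-∀

  ascending⇒identity : ∀ f → Mirrored f → (∀ k → k < n → f k < f (suc k)) →
    ∀ x → x < suc ω → f x ≡ x
  ascending⇒identity f mirrored ascending x x<1+ω = ≤-antisym (atMost x x<1+ω) (atLeast x x<1+ω)
    where
    ascendingEverywhere : ∀ k → suc k < suc ω → f k < f (suc k)
    ascendingEverywhere k k+1<1+ω with k <? n
    ... | yes k<n = ascending k k<n
    ... | no k≮n = <-complement
        (mirrored (trans (+-comm k′ (suc k)) k+1+k′≡ω))
        (mirrored (trans (+-comm (suc k′) k) (trans (+-suc k k′) k+1+k′≡ω)))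
        (ascending k′ k′<n)
      where
      k′ = ω ∸ suc k
      k+1+k′≡ω : suc k + k′ ≡ ω
      k+1+k′≡ω = m+[n∸m]≡n (≤-pred k+1<1+ω)
      k′<n : k′ < n
      k′<n = ≰⇒> λ n≤k′ → <-irrefl refl (<-≤-trans
        (+-monoˡ-< n (n<1+n m))
        (subst (n + n ≤_) k+1+k′≡ω (+-mono-≤ (≤-trans (≮⇒≥ k≮n) (n≤1+n k)) n≤k′)))
    atLeast : ∀ x → x < suc ω → x ≤ f x
    atLeast zero    _      = z≤n
    atLeast (suc x) x+1<1+ω =
      ≤-trans (s≤s (atLeast x (<-trans (n<1+n x) x+1<1+ω))) (ascendingEverywhere x x+1<1+ω)
    atMost : ∀ x → x < suc ω → f x ≤ x
    atMost x x<1+ω = ≤-complement (m∸n+n≡m x≤ω) (mirrored (m∸n+n≡m x≤ω))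
                                  (atLeast (ω ∸ x) (s≤s (m∸n≤m ω x)))
      where
      x≤ω = ≤-pred x<1+ω

module SignedAlphabet {n : ℕ} where

  -‿involutive : ∀ (x : PM n) → - (- x) ≡ x
  -‿involutive (pos k) = refl
  -‿involutive (neg k) = refl

  -‿injective : ∀ {x y : PM n} → - x ≡ - y → x ≡ y
  -‿injective {x} {y} -x≡-y = trans (sym (-‿involutive x)) (trans (cong -_ -x≡-y) (-‿involutive y))

  -x≡y⇒x≡-y : ∀ {x y : PM n} → - x ≡ y → x ≡ - y
  -x≡y⇒x≡-y {x} -x≡y = trans (sym (-‿involutive x)) (cong -_ -x≡y)

  x≢-x : ∀ (x : PM n) → x ≢ - x
  x≢-x (pos k) ()
  x≢-x (neg k) ()

  data TransposeView (t q y : PM n) : PM n → Set where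
    at-t     : y ≡ t → TransposeView t q y q
    at-q     : y ≢ t → y ≡ q → TransposeView t q y t
    at-neg-t : y ≢ t → y ≢ q → y ≡ - t → TransposeView t q y (- q)
    at-neg-q : y ≢ t → y ≢ q → y ≢ - t → y ≡ - q → TransposeView t q y (- t)
    fixed    : y ≢ t → y ≢ q → y ≢ - t → y ≢ - q → TransposeView t q y y

  transposeView : ∀ t q y → TransposeView t q y (τfun t q y)
  transposeView t q y with y ≟PM t
  ... | yes y≡t = at-t y≡t
  ... | no y≢t with y ≟PM q
  ...   | yes y≡q = at-q y≢t y≡q
  ...   | no y≢q with y ≟PM (- t)
  ...     | yes y≡-t = at-neg-t y≢t y≢q y≡-t
  ...     | no y≢-t with y ≟PM (- q)
  ...       | yes y≡-q = at-neg-q y≢t y≢q y≢-t y≡-q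
  ...       | no y≢-q  = fixed y≢t y≢q y≢-t y≢-q

  τfun-t : ∀ t q → τfun t q t ≡ q
  τfun-t t q with τfun t q t | transposeView t q t
  ... | _ | at-t _               = refl
  ... | _ | at-q t≢t _           = ⊥-elim (t≢t refl)
  ... | _ | at-neg-t t≢t _ _     = ⊥-elim (t≢t refl)
  ... | _ | at-neg-q t≢t _ _ _   = ⊥-elim (t≢t refl)
  ... | _ | fixed t≢t _ _ _      = ⊥-elim (t≢t refl)

  τfun-q : ∀ t q → τfun t q q ≡ t
  τfun-q t q with τfun t q q | transposeView t q q
  ... | _ | at-t q≡t             = q≡t
  ... | _ | at-q _ _             = refl
  ... | _ | at-neg-t _ q≢q _     = ⊥-elim (q≢q refl)
  ... | _ | at-neg-q _ q≢q _ _   = ⊥-elim (q≢q refl)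
  ... | _ | fixed _ q≢q _ _      = ⊥-elim (q≢q refl)

  τfun-neg-t : ∀ t q → τfun t q (- t) ≡ - q
  τfun-neg-t t q with τfun t q (- t) | transposeView t q (- t)
  ... | _ | at-t -t≡t            = ⊥-elim (x≢-x t (sym -t≡t))
  ... | _ | at-q _ -t≡q          = -x≡y⇒x≡-y -t≡q
  ... | _ | at-neg-t _ _ _       = refl
  ... | _ | at-neg-q _ _ -t≢-t _ = ⊥-elim (-t≢-t refl)
  ... | _ | fixed _ _ -t≢-t _    = ⊥-elim (-t≢-t refl)

  τfun-neg-q : ∀ t q → τfun t q (- q) ≡ - t
  τfun-neg-q t q with τfun t q (- q) | transposeView t q (- q)
  ... | _ | at-t -q≡t            = -x≡y⇒x≡-y -q≡t
  ... | _ | at-q _ -q≡q          = ⊥-elim (x≢-x q (sym -q≡q))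
  ... | _ | at-neg-t _ _ -q≡-t   = -q≡-t
  ... | _ | at-neg-q _ _ _ _     = refl
  ... | _ | fixed _ _ _ -q≢-q    = ⊥-elim (-q≢-q refl)

  τfun-fixed : ∀ t q y → y ≢ t → y ≢ q → y ≢ - t → y ≢ - q → τfun t q y ≡ y
  τfun-fixed t q y y≢t y≢q y≢-t y≢-q with τfun t q y | transposeView t q y
  ... | _ | at-t y≡t             = ⊥-elim (y≢t y≡t)
  ... | _ | at-q _ y≡q           = ⊥-elim (y≢q y≡q)
  ... | _ | at-neg-t _ _ y≡-t    = ⊥-elim (y≢-t y≡-t)
  ... | _ | at-neg-q _ _ _ y≡-q  = ⊥-elim (y≢-q y≡-q)
  ... | _ | fixed _ _ _ _        = refl

  τfun-involutive : ∀ t q y → τfun t q (τfun t q y) ≡ y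
  τfun-involutive t q y with τfun t q y | transposeView t q y
  ... | _ | at-t y≡t                    = trans (τfun-q t q) (sym y≡t)
  ... | _ | at-q _ y≡q                  = trans (τfun-t t q) (sym y≡q)
  ... | _ | at-neg-t _ _ y≡-t           = trans (τfun-neg-q t q) (sym y≡-t)
  ... | _ | at-neg-q _ _ _ y≡-q         = trans (τfun-neg-t t q) (sym y≡-q)
  ... | _ | fixed y≢t y≢q y≢-t y≢-q     = τfun-fixed t q y y≢t y≢q y≢-t y≢-q

  τfun-odd : ∀ t q y → τfun t q (- y) ≡ - (τfun t q y)
  τfun-odd t q y with τfun t q y | transposeView t q y
  ... | _ | at-t refl             = τfun-neg-t t q
  ... | _ | at-q _ refl           = τfun-neg-q t q
  ... | _ | at-neg-t _ _ refl     =
    trans (cong (τfun t q) (-‿involutive t)) (trans (τfun-t t q) (sym (-‿involutive q)))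
  ... | _ | at-neg-q _ _ _ refl   =
    trans (cong (τfun t q) (-‿involutive q)) (trans (τfun-q t q) (sym (-‿involutive t)))
  ... | _ | fixed y≢t y≢q y≢-t y≢-q = τfun-fixed t q (- y)
    (λ -y≡t → y≢-t (-x≡y⇒x≡-y -y≡t)) (λ -y≡q → y≢-q (-x≡y⇒x≡-y -y≡q))
    (λ -y≡-t → y≢t (-‿injective -y≡-t)) (λ -y≡-q → y≢q (-‿injective -y≡-q))

  τ-signed : ∀ t q → IsSignedPerm (τ t q)
  τ-signed t q = record
    { odd = τfun-odd t q ; inv-fun = τfun-involutive t q ; fun-inv = τfun-involutive t q }

  idP-signed : IsSignedPerm (idP {n})
  idP-signed = record { odd = λ _ → refl ; inv-fun = λ _ → refl ; fun-inv = λ _ → refl }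

  ·-signed : ∀ {u w : Perm n} → IsSignedPerm u → IsSignedPerm w → IsSignedPerm (u · w)
  ·-signed {u} {w} u-signed w-signed = record
    { odd     = λ x → trans (cong (fun u) (odd w-signed x)) (odd u-signed (fun w x))
    ; inv-fun = λ x → trans (cong (inv w) (inv-fun u-signed (fun w x))) (inv-fun w-signed x)
    ; fun-inv = λ x → trans (cong (fun u) (fun-inv w-signed (inv u x))) (fun-inv u-signed x)
    }
    where open IsSignedPerm

  inv-odd : ∀ {w : Perm n} → IsSignedPerm w → ∀ y → inv w (- y) ≡ - (inv w y)
  inv-odd {w} w-signed y = begin
    inv w (- y)                    ≡⟨ cong (λ z → inv w (- z)) (sym (fun-inv y)) ⟩
    inv w (- fun w (inv w y))      ≡⟨ cong (inv w) (sym (odd (inv w y))) ⟩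
    inv w (fun w (- (inv w y)))    ≡⟨ inv-fun _ ⟩
    - (inv w y)                    ∎
    where
    open ≡-Reasoning
    open IsSignedPerm w-signed

  inv-cong : ∀ {u w : Perm n} → IsSignedPerm u → IsSignedPerm w → u ≈ w → ∀ y → inv u y ≡ inv w y
  inv-cong {u} {w} u-signed w-signed u≈w y = begin
    inv u y                     ≡⟨ cong (inv u) (sym (IsSignedPerm.fun-inv w-signed y)) ⟩
    inv u (fun w (inv w y))     ≡⟨ cong (inv u) (sym (u≈w (inv w y))) ⟩
    inv u (fun u (inv w y))     ≡⟨ IsSignedPerm.inv-fun u-signed (inv w y) ⟩
    inv w y                     ∎
    where open ≡-Reasoning

module Hopping {n : ℕ} where
  open SignedAlphabet {n}

  Precedes : Perm n → PM n → PM n → Set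
  Precedes w a b = inv w a <PM inv w b

  hopStep-hops : ∀ t q (w : Perm n) → t <PM q → Precedes w t q → hopStep t (q ∷ []) w ≡ just (τ t q · w)
  hopStep-hops t q w t<q t≺q with t <PM? q | inv w t <PM? inv w q
  ... | yes _   | yes _    = refl
  ... | no t≮q  | _        = ⊥-elim (t≮q t<q)
  ... | yes _   | no t⊀q   = ⊥-elim (t⊀q t≺q)

  hopStep-stops : ∀ t q (w : Perm n) → ¬ Precedes w t q → hopStep t (q ∷ []) w ≡ nothing
  hopStep-stops t q w t⊀q with t <PM? q | inv w t <PM? inv w q
  ... | yes _ | yes t≺q = ⊥-elim (t⊀q t≺q)
  ... | yes _ | no _      = refl
  ... | no _  | _         = refl

  hop-undoes : ∀ {t q} (u : Perm n) k → 2 ≤ k → t <PM q → Precedes u q t →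
    hopIter k t (q ∷ []) (τ t q · u) ≈ u
  hop-undoes u (suc zero) (s≤s ()) _ _
  hop-undoes {t} {q} u (suc (suc k)) _ t<q q≺t x
    rewrite hopStep-hops t q (τ t q · u) t<q (subst₂ (Precedes u) (sym (τfun-t t q)) (sym (τfun-q t q)) q≺t)
          | hopStep-stops t q (τ t q · (τ t q · u))
              (λ t≺q → <-asym q≺t (subst₂ (Precedes u) (τfun-involutive t q t) (τfun-involutive t q q) t≺q))
    = τfun-involutive t q (fun u x)

  hop-stays : ∀ {t q} (u : Perm n) k → 1 ≤ k → ¬ Precedes u q t →
    hopIter k t (q ∷ []) (τ t q · u) ≈ (τ t q · u)
  hop-stays {t} {q} u (suc k) _ q⊀t x
    rewrite hopStep-stops t q (τ t q · u) (λ t≺q → q⊀t (subst₂ (Precedes u) (τfun-t t q) (τfun-q t q) t≺q))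
    = refl

module Ranks (m : ℕ) where
  open Mirror m public
  open SignedAlphabet {n}

  toℕ≤m : ∀ (k : Fin n) → toℕ k ≤ m
  toℕ≤m k = ≤-pred (Fin.toℕ<n k)

  rank-negate : ∀ (y : PM n) → rank y + rank (- y) ≡ ω
  rank-negate (pos k) = begin
    toℕ k + (n + (m ∸ toℕ k))  ≡⟨ x∙yz≈y∙xz (toℕ k) n (m ∸ toℕ k) ⟩
    n + (toℕ k + (m ∸ toℕ k))  ≡⟨ cong (n +_) (m+[n∸m]≡n (toℕ≤m k)) ⟩
    n + m                      ≡⟨ +-comm n m ⟩
    ω                          ∎
    where open ≡-Reasoning
  rank-negate (neg k) = trans (+-comm (rank (neg k)) (toℕ k)) (rank-negate (pos k))

  rank-mirror : ∀ (y : PM n) → rank (- y) ≡ ω ∸ rank y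
  rank-mirror y = sym (+≡⇒∸≡ (rank-negate y))

  rank-neg-last : ∀ {k : Fin n} → toℕ k ≡ m → rank (neg k) ≡ suc (toℕ k)
  rank-neg-last {k} k≡m = begin
    n + (m ∸ toℕ k)  ≡⟨ cong (λ i → n + (m ∸ i)) k≡m ⟩
    n + (m ∸ m)      ≡⟨ cong (n +_) (n∸n≡0 m) ⟩
    n + 0            ≡⟨ +-identityʳ n ⟩
    suc m            ≡⟨ cong suc (sym k≡m) ⟩
    suc (toℕ k)      ∎
    where open ≡-Reasoning

  rank< : ∀ (y : PM n) → rank y < suc ω
  rank< y = s≤s (subst (rank y ≤_) (rank-negate y) (m≤m+n (rank y) (rank (- y))))

  ω∸x<n : ∀ {x} → n ≤ x → ω ∸ x < n
  ω∸x<n {x} n≤x = s≤s (subst (ω ∸ x ≤_) (m+n∸n≡m m n) (∸-monoʳ-≤ ω n≤x))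

  unrank : ℕ → PM n
  unrank x with x <? n
  ... | yes x<n = pos (fromℕ< x<n)
  ... | no x≮n  = neg (fromℕ< (ω∸x<n (≮⇒≥ x≮n)))

  rank-unrank : ∀ x → x < suc ω → rank (unrank x) ≡ x
  rank-unrank x x<1+ω with x <? n
  ... | yes x<n = Fin.toℕ-fromℕ< x<n
  ... | no x≮n  = +-cancelˡ-≡ (ω ∸ x) _ _ (begin
    (ω ∸ x) + rank (neg k)  ≡⟨ cong (_+ rank (neg k)) (sym (Fin.toℕ-fromℕ< (ω∸x<n n≤x))) ⟩
    toℕ k + rank (neg k)    ≡⟨ rank-negate (pos k) ⟩
    ω                       ≡⟨ sym (m∸n+n≡m (≤-pred x<1+ω)) ⟩
    (ω ∸ x) + x             ∎)
    where
    open ≡-Reasoning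
    n≤x = ≮⇒≥ x≮n
    k = fromℕ< (ω∸x<n n≤x)

  unrank-rank : ∀ (y : PM n) → unrank (rank y) ≡ y
  unrank-rank (pos k) with toℕ k <? n
  ... | yes k<n = cong pos (Fin.fromℕ<-toℕ k k<n)
  ... | no k≮n  = ⊥-elim (k≮n (Fin.toℕ<n k))
  unrank-rank (neg k) with rank (neg k) <? n
  ... | yes r<n = ⊥-elim (<-irrefl refl (<-≤-trans r<n (m≤m+n n (m ∸ toℕ k))))
  ... | no _    = cong neg (Fin.toℕ-injective
    (trans (Fin.toℕ-fromℕ< _) (+≡⇒∸≡ (trans (+-comm (rank (neg k)) (toℕ k)) (rank-negate (pos k))))))

  rank-injective : ∀ {x y : PM n} → rank x ≡ rank y → x ≡ y
  rank-injective {x} {y} rx≡ry = trans (sym (unrank-rank x)) (trans (cong unrank rx≡ry) (unrank-rank y))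

  unrank-mirror : ∀ x → x < suc ω → unrank (ω ∸ x) ≡ - unrank x
  unrank-mirror x x<1+ω = begin
    unrank (ω ∸ x)                     ≡⟨ cong (λ r → unrank (ω ∸ r)) (sym (rank-unrank x x<1+ω)) ⟩
    unrank (ω ∸ rank (unrank x))       ≡⟨ cong unrank (sym (rank-mirror (unrank x))) ⟩
    unrank (rank (- unrank x))         ≡⟨ unrank-rank (- unrank x) ⟩
    - unrank x                         ∎
    where open ≡-Reasoning

module Lengths (m : ℕ) where
  open Ranks m public
  open SignedAlphabet {n}
  open Hopping {n}

  position : Perm n → ℕ → ℕ
  position w x = rank (inv w (unrank x))

  position-rank : ∀ w (y : PM n) → position w (rank y) ≡ rank (inv w y)
  position-rank w y = cong (rank ∘ inv w) (unrank-rank y)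

  position-mirrored : ∀ {w} → IsSignedPerm w → Mirrored (position w)
  position-mirrored {w} w-signed {x} {y} x+y≡ω = trans (cong (position w x +_) (begin
    position w y                   ≡⟨ cong (position w) (sym (+≡⇒∸≡ x+y≡ω)) ⟩
    rank (inv w (unrank (ω ∸ x)))  ≡⟨ cong (rank ∘ inv w) (unrank-mirror x x<1+ω) ⟩
    rank (inv w (- unrank x))      ≡⟨ cong rank (inv-odd w-signed (unrank x)) ⟩
    rank (- inv w (unrank x))      ∎))
    (rank-negate (inv w (unrank x)))
    where
    open ≡-Reasoning
    x<1+ω : x < suc ω
    x<1+ω = s≤s (subst (x ≤_) x+y≡ω (m≤m+n x y))

  position-injective : ∀ {w} → IsSignedPerm w → ∀ {x y} → x < suc ω → y < suc ω →
    position w x ≡ position w y → x ≡ y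
  position-injective {w} w-signed {x} {y} x<1+ω y<1+ω px≡py = begin
    x                ≡⟨ sym (rank-unrank x x<1+ω) ⟩
    rank (unrank x)  ≡⟨ cong rank (begin
      unrank x                  ≡⟨ sym (fun-inv (unrank x)) ⟩
      fun w (inv w (unrank x))  ≡⟨ cong (fun w) (rank-injective px≡py) ⟩
      fun w (inv w (unrank y))  ≡⟨ fun-inv (unrank y) ⟩
      unrank y                  ∎) ⟩
    rank (unrank y)  ≡⟨ rank-unrank y y<1+ω ⟩
    y                ∎
    where
    open ≡-Reasoning
    open IsSignedPerm w-signed

  Descent : Fin n → Perm n → Set
  Descent j w = position w (suc (toℕ j)) < position w (toℕ j)

  descent? : ∀ j w → Dec (Descent j w)
  descent? j w = _ <? _

  2ℓ : Perm n → ℕ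
  2ℓ w = doubledLength (position w)

  2ℓ-cong : ∀ {u w} → IsSignedPerm u → IsSignedPerm w → u ≈ w → 2ℓ u ≡ 2ℓ w
  2ℓ-cong u-signed w-signed u≈w =
    doubledLength-cong (λ x _ → cong rank (inv-cong u-signed w-signed u≈w (unrank x)))

  2ℓ-idP : 2ℓ idP ≡ 0
  2ℓ-idP = doubledLength-id rank-unrank

  private
    relabel : ∀ (σ : ℕ → ℕ) (y z : PM n) {r r′} →
      rank y ≡ r → rank z ≡ r′ → σ r ≡ r′ → rank z ≡ σ (rank y)
    relabel σ y z refl refl σr≡r′ = sym σr≡r′

    rank-≢ : ∀ {y z : PM n} {r} → y ≢ z → rank z ≡ r → rank y ≢ r
    rank-≢ y≢z refl ry≡rz = y≢z (rank-injective ry≡rz)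

  rank-τ-inner : ∀ {t q : PM n} {k a} → rank t ≡ k → rank q ≡ suc k →
    rank (- q) ≡ a → rank (- t) ≡ suc a → suc k < a →
    ∀ y → rank (τfun t q y) ≡ swapAdj a (swapAdj k (rank y))
  rank-τ-inner {t} {q} {k} {a} rt rq r-q r-t k+1<a y with τfun t q y | transposeView t q y
  ... | _ | at-t refl = relabel (swapAdj a ∘ swapAdj k) t q rt rq
    (trans (cong (swapAdj a) (swapAdj-left k)) (swapAdj-below a (suc k) k+1<a))
  ... | _ | at-q _ refl = relabel (swapAdj a ∘ swapAdj k) q t rq rt
    (trans (cong (swapAdj a) (swapAdj-right k)) (swapAdj-below a k (<-trans (n<1+n k) k+1<a)))
  ... | _ | at-neg-t _ _ refl = relabel (swapAdj a ∘ swapAdj k) (- t) (- q) r-t r-q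
    (trans (cong (swapAdj a) (swapAdj-above k (suc a) (<-trans k+1<a (n<1+n a)))) (swapAdj-right a))
  ... | _ | at-neg-q _ _ _ refl = relabel (swapAdj a ∘ swapAdj k) (- q) (- t) r-q r-t
    (trans (cong (swapAdj a) (swapAdj-above k a k+1<a)) (swapAdj-left a))
  ... | _ | fixed y≢t y≢q y≢-t y≢-q = sym (trans
    (cong (swapAdj a) (swapAdj-other k (rank y) (rank-≢ y≢t rt) (rank-≢ y≢q rq)))
    (swapAdj-other a (rank y) (rank-≢ y≢-q r-q) (rank-≢ y≢-t r-t)))

  rank-τ-last : ∀ {t : PM n} {k} → rank t ≡ k → rank (- t) ≡ suc k →
    ∀ y → rank (τfun t (- t) y) ≡ swapAdj k (rank y)
  rank-τ-last {t} {k} rt r-t y with τfun t (- t) y | transposeView t (- t) y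
  ... | _ | at-t refl                = relabel (swapAdj k) t (- t) rt r-t (swapAdj-left k)
  ... | _ | at-q _ refl              = relabel (swapAdj k) (- t) t r-t rt (swapAdj-right k)
  ... | _ | at-neg-t _ y≢-t y≡-t     = ⊥-elim (y≢-t y≡-t)
  ... | _ | at-neg-q y≢t _ _ y≡-q    = ⊥-elim (y≢t (trans y≡-q (-‿involutive t)))
  ... | _ | fixed y≢t y≢-t _ _       =
    sym (swapAdj-other k (rank y) (rank-≢ y≢t rt) (rank-≢ y≢-t r-t))

  gen-inner : ∀ (j : Fin n) (k+1<n : suc (toℕ j) < n) → gen j ≡ τ (pos j) (pos (fromℕ< k+1<n))
  gen-inner j k+1<n with suc (toℕ j) <? n
  ... | yes _     = refl
  ... | no k+1≮n  = ⊥-elim (k+1≮n k+1<n)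

  gen-last : ∀ (j : Fin n) → ¬ suc (toℕ j) < n → gen j ≡ τ (pos j) (neg j)
  gen-last j k+1≮n with suc (toℕ j) <? n
  ... | yes k+1<n = ⊥-elim (k+1≮n k+1<n)
  ... | no _      = refl

  record GeneratorAction (j : Fin n) : Set where
    field
      t q   : PM n
      σ     : ℕ → ℕ
      gen≡τ : gen j ≡ τ t q
      rank-t : rank t ≡ toℕ j
      rank-q : rank q ≡ suc (toℕ j)
      rank-τ : ∀ y → rank (τfun t q y) ≡ σ (rank y)
      doubledLength-σ : ∀ f → Mirrored f → f (suc (toℕ j)) < f (toℕ j) →
        doubledLength (f ∘ σ) + 2 ≡ doubledLength f

  generatorAction : ∀ j → GeneratorAction j
  generatorAction j with suc (toℕ j) <? n
  ... | yes k+1<n = record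
    { t = pos j ; q = pos (fromℕ< k+1<n) ; σ = swapAdj a ∘ swapAdj k
    ; gen≡τ = gen-inner j k+1<n ; rank-t = refl ; rank-q = rank-q
    ; rank-τ = rank-τ-inner refl rank-q (trans (rank-mirror (pos (fromℕ< k+1<n))) (cong (ω ∸_) rank-q)) rank-neg-t
                 (≤-trans k+1<n (n≤ω∸[1+k] k+1<n))
    ; doubledLength-σ = λ f mirrored → doubledLength-inner f k mirrored k+1<n
    }
    where
    k = toℕ j
    a = ω ∸ suc k
    rank-q : rank (pos (fromℕ< k+1<n)) ≡ suc k
    rank-q = Fin.toℕ-fromℕ< k+1<n
    rank-neg-t : rank (neg j) ≡ suc a
    rank-neg-t = trans (rank-mirror (pos j)) ((+-∸-assoc 1 (≤-trans (≤-pred k+1<n) (m≤m+n m n))))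
  ... | no k+1≮n = record
    { t = pos j ; q = neg j ; σ = swapAdj (toℕ j)
    ; gen≡τ = gen-last j k+1≮n ; rank-t = refl ; rank-q = rank-neg-last k≡m
    ; rank-τ = rank-τ-last refl (rank-neg-last k≡m)
    ; doubledLength-σ = subst
        (λ k → ∀ f → Mirrored f → f (suc k) < f k → doubledLength (f ∘ swapAdj k) + 2 ≡ doubledLength f)
        (sym k≡m) doubledLength-last
    }
    where
    k≡m : toℕ j ≡ m
    k≡m = ≤-antisym (toℕ≤m j) (≤-pred (≮⇒≥ k+1≮n))

  module _ (j : Fin n) where
    open GeneratorAction (generatorAction j)

    gen-signed : IsSignedPerm (gen j)
    gen-signed = subst IsSignedPerm (sym gen≡τ) (τ-signed t q)

    gen-involutive : ∀ w → (gen j · (gen j · w)) ≈ w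
    gen-involutive w x = begin
      fun (gen j) (fun (gen j) (fun w x))  ≡⟨ cong (λ g → fun g (fun g (fun w x))) gen≡τ ⟩
      τfun t q (τfun t q (fun w x))        ≡⟨ τfun-involutive t q (fun w x) ⟩
      fun w x                              ∎
      where open ≡-Reasoning

    position-gen· : ∀ w x → x < suc ω → position (gen j · w) x ≡ position w (σ x)
    position-gen· w x x<1+ω = cong (rank ∘ inv w) (begin
      inv (gen j) (unrank x)                ≡⟨ cong (λ g → inv g (unrank x)) gen≡τ ⟩
      τfun t q (unrank x)                   ≡⟨ sym (unrank-rank _) ⟩
      unrank (rank (τfun t q (unrank x)))   ≡⟨ cong unrank (rank-τ (unrank x)) ⟩
      unrank (σ (rank (unrank x)))          ≡⟨ cong (unrank ∘ σ) (rank-unrank x x<1+ω) ⟩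
      unrank (σ x)                          ∎)
      where open ≡-Reasoning

    σ-k : σ (toℕ j) ≡ suc (toℕ j)
    σ-k = trans (cong σ (sym rank-t)) (trans (sym (rank-τ t)) (trans (cong rank (τfun-t t q)) rank-q))

    σ-suc-k : σ (suc (toℕ j)) ≡ toℕ j
    σ-suc-k = trans (cong σ (sym rank-q)) (trans (sym (rank-τ q)) (trans (cong rank (τfun-q t q)) rank-t))

    k+1<1+ω : suc (toℕ j) < suc ω
    k+1<1+ω = s≤s (≤-trans (Fin.toℕ<n j) (m≤n+m n m))

    k<1+ω : toℕ j < suc ω
    k<1+ω = <⇒<1+ω (Fin.toℕ<n j)

    descent⇒2ℓ-drop : ∀ {w} → IsSignedPerm w → Descent j w → 2ℓ (gen j · w) + 2 ≡ 2ℓ w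
    descent⇒2ℓ-drop {w} w-signed descent =
      trans (cong (_+ 2) (doubledLength-cong (position-gen· w)))
            (doubledLength-σ (position w) (position-mirrored w-signed) descent)

    descent⇒2ℓ< : ∀ {w} → IsSignedPerm w → Descent j w → 2ℓ (gen j · w) < 2ℓ w
    descent⇒2ℓ< w-signed descent =
      <-≤-trans (m<m+n _ z<s) (≤-reflexive (descent⇒2ℓ-drop w-signed descent))

    ¬descent⇒descent : ∀ {w} → IsSignedPerm w → ¬ Descent j w → Descent j (gen j · w)
    ¬descent⇒descent {w} w-signed ¬descent = subst₂ _<_
      (sym (trans (position-gen· w _ k+1<1+ω) (cong (position w) σ-suc-k)))
      (sym (trans (position-gen· w _ k<1+ω) (cong (position w) σ-k)))
      (≤∧≢⇒< (≮⇒≥ ¬descent) λ pk≡pk+1 →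
        1+n≢n (sym (position-injective w-signed k<1+ω k+1<1+ω pk≡pk+1)))

    ¬descent⇒2ℓ-rise : ∀ {w} → IsSignedPerm w → ¬ Descent j w → 2ℓ w + 2 ≡ 2ℓ (gen j · w)
    ¬descent⇒2ℓ-rise {w} w-signed ¬descent = begin
      2ℓ w + 2
        ≡⟨ cong (_+ 2) (2ℓ-cong w-signed gw-signed′ (λ x → sym (gen-involutive w x))) ⟩
      2ℓ (gen j · (gen j · w)) + 2
        ≡⟨ descent⇒2ℓ-drop gw-signed (¬descent⇒descent w-signed ¬descent) ⟩
      2ℓ (gen j · w) ∎
      where
      open ≡-Reasoning
      gw-signed = ·-signed gen-signed w-signed
      gw-signed′ = ·-signed gen-signed gw-signed

  noDescent⇒≈idP : ∀ {w} → IsSignedPerm w → (∀ j → ¬ Descent j w) → w ≈ idP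
  noDescent⇒≈idP {w} w-signed noDescent y = begin
    fun w y            ≡⟨ cong (fun w) (sym inv-y≡y) ⟩
    fun w (inv w y)    ≡⟨ IsSignedPerm.fun-inv w-signed y ⟩
    y                  ∎
    where
    open ≡-Reasoning
    ascending : ∀ k → k < n → position w k < position w (suc k)
    ascending k k<n = ≤∧≢⇒< (≮⇒≥ ¬descent) λ pk≡pk+1 →
      1+n≢n (sym (position-injective w-signed (<⇒<1+ω k<n) (s≤s (≤-trans k<n (m≤n+m n m))) pk≡pk+1))
      where
      ¬descent : ¬ position w (suc k) < position w k
      ¬descent = subst (λ i → ¬ position w (suc i) < position w i) (Fin.toℕ-fromℕ< k<n) (noDescent (fromℕ< k<n))
    inv-y≡y : inv w y ≡ y
    inv-y≡y = rank-injective (trans (sym (position-rank w y))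
      (ascending⇒identity (position w) (position-mirrored w-signed) ascending (rank y) (rank< y)))

  eval-signed : ∀ ws → IsSignedPerm (eval ws)
  eval-signed []       = idP-signed
  eval-signed (j ∷ ws) = ·-signed (gen-signed j) (eval-signed ws)

  private
    double-suc : ∀ l → suc l + suc l ≡ (l + l) + 2
    double-suc = solve-∀

  2ℓ-eval≤ : ∀ ws → 2ℓ (eval ws) ≤ length ws + length ws
  2ℓ-eval≤ [] = ≤-reflexive 2ℓ-idP
  2ℓ-eval≤ (j ∷ ws) with descent? j (eval ws)
  ... | yes descent = begin
    2ℓ (gen j · eval ws)          ≤⟨ m≤m+n _ 2 ⟩
    2ℓ (gen j · eval ws) + 2      ≡⟨ descent⇒2ℓ-drop j (eval-signed ws) descent ⟩
    2ℓ (eval ws)                  ≤⟨ 2ℓ-eval≤ ws ⟩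
    length ws + length ws         ≤⟨ +-mono-≤ (n≤1+n _) (n≤1+n _) ⟩
    suc (length ws) + suc (length ws) ∎
    where open ≤-Reasoning
  ... | no ¬descent = begin
    2ℓ (gen j · eval ws)          ≡⟨ sym (¬descent⇒2ℓ-rise j (eval-signed ws) ¬descent) ⟩
    2ℓ (eval ws) + 2              ≤⟨ +-monoˡ-≤ 2 (2ℓ-eval≤ ws) ⟩
    (length ws + length ws) + 2   ≡⟨ sym (double-suc (length ws)) ⟩
    suc (length ws) + suc (length ws) ∎
    where open ≤-Reasoning

  reducedWord : ∀ k w → IsSignedPerm w → 2ℓ w ≤ k →
    Σ (List (Fin n)) λ ws → (length ws + length ws ≡ 2ℓ w) × (eval ws ≈ w)
  reducedWord k w w-signed 2ℓ≤k with Fin.any? (λ j → descent? j w)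
  ... | no noDescent =
    [] , trans (sym 2ℓ-idP) (2ℓ-cong idP-signed w-signed (λ x → sym (w≈id x))) , (λ x → sym (w≈id x))
    where w≈id = noDescent⇒≈idP w-signed (λ j descent → noDescent (j , descent))
  reducedWord zero w w-signed 2ℓ≤0 | yes (j , descent) =
    ⊥-elim (n≮0 (<-≤-trans (descent⇒2ℓ< j w-signed descent) 2ℓ≤0))
  reducedWord (suc k) w w-signed 2ℓ≤1+k | yes (j , descent)
    with reducedWord k (gen j · w) (·-signed (gen-signed j) w-signed)
                     (≤-pred (<-≤-trans (descent⇒2ℓ< j w-signed descent) 2ℓ≤1+k))
  ... | ws , length≡ , eval≈ =
    j ∷ ws ,
    trans (double-suc (length ws)) (trans (cong (_+ 2) length≡) (descent⇒2ℓ-drop j w-signed descent)) ,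
    (λ x → trans (cong (fun (gen j)) (eval≈ x)) (gen-involutive j w x))

  hasLength⇒2ℓ : ∀ {w b} → IsSignedPerm w → HasLength w b → b + b ≡ 2ℓ w
  hasLength⇒2ℓ {w} {b} w-signed ((ws , length≡b , eval≈w) , minimal)
    with reducedWord (2ℓ w) w w-signed ≤-refl
  ... | ws′ , length≡ , eval≈w′ = ≤-antisym
    (subst (b + b ≤_) length≡ (+-mono-≤ (minimal ws′ eval≈w′) (minimal ws′ eval≈w′)))
    (subst₂ _≤_ (2ℓ-cong (eval-signed ws) w-signed eval≈w) (cong₂ _+_ length≡b length≡b) (2ℓ-eval≤ ws))

  private
    halve< : ∀ {x y} → (x + x) + 2 ≡ y + y → x < y
    halve< {x} {y} x+x+2≡y+y = ≰⇒> λ y≤x → <-irrefl refl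
      (≤-<-trans (+-mono-≤ y≤x y≤x) (subst (x + x <_) x+x+2≡y+y (m<m+n (x + x) z<s)))

  isDemazure-byDescent : ∀ j {u r} → IsSignedPerm u →
    (Descent j u → r ≈ u) → (¬ Descent j u → r ≈ (gen j · u)) → IsDemazure (gen j) u r
  isDemazure-byDescent j {u} u-signed r≈u r≈gu a b len[gu]≡a len[u]≡b with descent? j u
  ... | yes descent = (λ _ → r≈u descent) , λ a≮b → ⊥-elim (a≮b (halve< (begin
    (a + a) + 2           ≡⟨ cong (_+ 2) (hasLength⇒2ℓ gu-signed len[gu]≡a) ⟩
    2ℓ (gen j · u) + 2    ≡⟨ descent⇒2ℓ-drop j u-signed descent ⟩
    2ℓ u                  ≡⟨ sym (hasLength⇒2ℓ u-signed len[u]≡b) ⟩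
    b + b                 ∎)))
    where
    open ≡-Reasoning
    gu-signed = ·-signed (gen-signed j) u-signed
  ... | no ¬descent = (λ a<b → ⊥-elim (<-asym a<b (halve< (begin
    (b + b) + 2           ≡⟨ cong (_+ 2) (hasLength⇒2ℓ u-signed len[u]≡b) ⟩
    2ℓ u + 2              ≡⟨ ¬descent⇒2ℓ-rise j u-signed ¬descent ⟩
    2ℓ (gen j · u)        ≡⟨ sym (hasLength⇒2ℓ gu-signed len[gu]≡a) ⟩
    a + a                 ∎)))) , λ _ → r≈gu ¬descent
    where
    open ≡-Reasoning
    gu-signed = ·-signed (gen-signed j) u-signed

  demazure-hop : ∀ {u} → IsSignedPerm u → ∀ j {t q} → gen j ≡ τ t q →
    rank t ≡ toℕ j → rank q ≡ suc (toℕ j) → IsDemazure (gen j) u (hop t (q ∷ []) (gen j · u))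
  demazure-hop {u} u-signed j {t} {q} gen≡τ rank-t rank-q =
    isDemazure-byDescent j {r = hop t (q ∷ []) (gen j · u)} u-signed
      (λ descent → subst (λ g → hop t (q ∷ []) (g · u) ≈ u) (sym gen≡τ)
                     (hop-undoes u (2 * n) 2≤2n t<q (descent⇒q≺t descent)))
      (λ ¬descent → subst (λ g → hop t (q ∷ []) (g · u) ≈ (g · u)) (sym gen≡τ)
                     (hop-stays u (2 * n) (≤-trans (s≤s z≤n) 2≤2n) (¬descent ∘′ q≺t⇒descent)))
    where
    2≤2n : 2 ≤ 2 * n
    2≤2n = *-monoʳ-≤ 2 (s≤s z≤n)
    t<q : t <PM q
    t<q = subst₂ _<_ (sym rank-t) (sym rank-q) (n<1+n (toℕ j))
    position-q : position u (suc (toℕ j)) ≡ rank (inv u q)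
    position-q = trans (cong (position u) (sym rank-q)) (position-rank u q)
    position-t : position u (toℕ j) ≡ rank (inv u t)
    position-t = trans (cong (position u) (sym rank-t)) (position-rank u t)
    descent⇒q≺t : Descent j u → Precedes u q t
    descent⇒q≺t = subst₂ _<_ position-q position-t
    q≺t⇒descent : Precedes u q t → Descent j u
    q≺t⇒descent = subst₂ _<_ (sym position-q) (sym position-t)

lemma4p6 : (m : ℕ) → 1 ≤ m → (v : B (suc m)) →
    ((j : Fin (suc m)) → (p : suc (toℕ j) < suc m) →
      IsDemazure (gen j) (perm' v) (hop (pos j) (pos (fromℕ< p) ∷ []) (gen j · perm' v)))
    × IsDemazure (gen (fromℕ m)) (perm' v)
        (hop (pos (fromℕ m)) (neg (fromℕ m) ∷ []) (gen (fromℕ m) · perm' v))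
lemma4p6 m _ v =
  (λ j k+1<n → demazure-hop (signed v) j (gen-inner j k+1<n) refl (Fin.toℕ-fromℕ< k+1<n)) ,
  demazure-hop (signed v) (fromℕ m) (gen-last (fromℕ m) (<-irrefl (cong suc (Fin.toℕ-fromℕ m))))
               refl (rank-neg-last (Fin.toℕ-fromℕ m))
  where open Lengths m
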